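{- Let $G=(V,E)$ be an undirected graph with positive edge weights and $T\subseteq V$ a terminal set. For any extreme sets $X$ and $Y$, if $X\cap Y$ is nonempty, then $X\cap Y$ is a Steiner cut.
   Context: For $X\subseteq V$, $d(X)$ is the total weight of edges with exactly one endpoint in $X$. A Steiner cut is a set $X\subseteq V$ with $X\cap T\neq\emptyset$ and $T\not\subseteq X$. A Steiner cut $X$ is extreme if every Steiner cut $Y\subsetneq X$ satisfies $d(Y)>d(X)$.
   Formalization: The edge weights are positive rationals. -}

module Defs where

open import Data.Nat using (ℕ)
open import Data.Bool using (Bool; true; false; not; _∧_)
open import Data.Fin using (Fin)
open import Data.Fin.Subset using (Subset; _∈_; _⊆_; _⊂_; _∩_; Nonempty)
open import Data.Vec using (lookup)
open import Data.Vec.Functional using (foldr)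
open import Data.Product using (_×_; ∃)
open import Relation.Nullary using (¬_)
open import Relation.Binary.PropositionalEquality using (_≡_)
open import Data.Rational using (ℚ; 0ℚ; _+_; _<_; _≤_)

-- An undirected graph with positive edge weights is
-- a symmetric weight function w : Fin n → Fin n → ℚ with zero diagonal and
-- nonnegative entries; {u,v} is an edge iff w u v > 0 (its weight).
record WeightedGraph (n : ℕ) : Set where
  field
    w       : Fin n → Fin n → ℚ
    symm    : ∀ u v → w u v ≡ w v u
    noLoop  : ∀ u → w u u ≡ 0ℚ
    nonneg  : ∀ u v → 0ℚ ≤ w u v

open WeightedGraph public

Σ-fin : ∀ {n} → (Fin n → ℚ) → ℚ
Σ-fin f = foldr _+_ 0ℚ f

-- d(X): total weight of edges with exactly one endpoint in X.
-- Each such edge {u,v} (u ∈ X, v ∉ X) is counted once, via the ordered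
-- pair (u , v).
d : ∀ {n} → WeightedGraph n → Subset n → ℚ
d G X = Σ-fin λ u → Σ-fin λ v →
  crossing (lookup X u ∧ not (lookup X v)) (w G u v)
  where
  crossing : Bool → ℚ → ℚ
  crossing true  q = q
  crossing false _ = 0ℚ

SteinerCut : ∀ {n} → Subset n → Subset n → Set
SteinerCut T X = Nonempty (X ∩ T) × ¬ (T ⊆ X)

Extreme : ∀ {n} → WeightedGraph n → Subset n → Subset n → Set
Extreme G T X =
  SteinerCut T X × (∀ Y → Y ⊂ X → SteinerCut T Y → d G X < d G Y)

-- If the meet X ∩ Y of two extreme sets missed the terminals, then X − Y and
-- Y − X would be Steiner cuts strictly inside X and Y, so extremality would give
-- d(X − Y) + d(Y − X) > d(X) + d(Y).  This contradicts posimodularity of the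
-- cut function, which holds edge by edge.
module Submission where

open import Defs
open import Data.Nat using (ℕ)
open import Data.Bool using (Bool; true; false; not; _∧_; _xor_)
open import Data.Fin using (Fin; zero; suc)
open import Data.Fin.Subset using (Subset; inside; outside; _∈_; _∉_; _⊆_; _∩_; _─_; Nonempty)
open import Data.Fin.Subset.Properties
  using (nonempty?; ∩-comm; ⊆-trans; p∩q⊆p; x∈p∩q⁺; x∈p∩q⁻; p─q⊆p; x∈p∧x∉q⇒x∈p─q; p∩q≢∅⇒p─q⊂p)
open import Data.Vec using (_∷_; lookup)
open import Data.Rational using (ℚ; 0ℚ; 1ℚ; _+_; _*_; _<_; _≤_; _≤?_; nonNegative)
open import Data.Rational.Properties
  using (+-0-commutativeMonoid; +-mono-≤; +-mono-<; ≤-refl; <-irrefl; <-≤-trans; ≮⇒≥;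
         *-identityˡ; *-zeroˡ; *-distribʳ-+; *-monoʳ-≤-nonNeg; module ≤-Reasoning)
open import Algebra.Bundles using (CommutativeMonoid)
open import Algebra.Properties.CommutativeMonoid.Sum +-0-commutativeMonoid
  using (sum-cong-≗; ∑-distrib-+; ∑-comm)
open import Algebra.Properties.CommutativeSemigroup
  (CommutativeMonoid.commutativeSemigroup +-0-commutativeMonoid) using (interchange)
open import Data.Product using (_,_; proj₁; proj₂)
open import Function using (flip)
open import Relation.Nullary using (¬_)
open import Relation.Nullary.Decidable using (True; toWitness; decidable-stable)
open import Relation.Binary.PropositionalEquality
  using (_≡_; _≗_; refl; sym; trans; cong; cong₂; subst; subst₂; module ≡-Reasoning)

+-self-cancel-≤ : ∀ {p q : ℚ} → p + p ≤ q + q → p ≤ q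
+-self-cancel-≤ p+p≤q+q = ≮⇒≥ λ q<p → <-irrefl refl (<-≤-trans (+-mono-< q<p q<p) p+p≤q+q)

sum-mono-≤ : ∀ {n} {f g : Fin n → ℚ} → (∀ i → f i ≤ g i) → Σ-fin f ≤ Σ-fin g
sum-mono-≤ {ℕ.zero}  f≤g = ≤-refl
sum-mono-≤ {ℕ.suc n} f≤g = +-mono-≤ (f≤g zero) (sum-mono-≤ (λ i → f≤g (suc i)))

𝟙 : Bool → ℚ
𝟙 true  = 1ℚ
𝟙 false = 0ℚ

≤-by-decision : (p q : ℚ) {_ : True (p ≤? q)} → p ≤ q
≤-by-decision p q {p≤q} = toWitness p≤q

weighted : ∀ {n} → WeightedGraph n → (Fin n → Fin n → ℚ) → ℚ
weighted G f = Σ-fin λ u → Σ-fin λ v → f u v * w G u v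

module _ {n} (G : WeightedGraph n) where

  weighted-cong : ∀ {f g : Fin n → Fin n → ℚ} → (∀ u v → f u v ≡ g u v) → weighted G f ≡ weighted G g
  weighted-cong f≡g = sum-cong-≗ λ u → sum-cong-≗ λ v → cong (_* w G u v) (f≡g u v)

  weighted-+ : ∀ (f g : Fin n → Fin n → ℚ) →
    weighted G f + weighted G g ≡ weighted G (λ u v → f u v + g u v)
  weighted-+ f g = begin
    weighted G f + weighted G g
      ≡⟨ ∑-distrib-+ (λ u → Σ-fin λ v → f u v * w G u v) (λ u → Σ-fin λ v → g u v * w G u v) ⟨
    (Σ-fin λ u → (Σ-fin λ v → f u v * w G u v) + (Σ-fin λ v → g u v * w G u v))
      ≡⟨ sum-cong-≗ (λ u → ∑-distrib-+ (λ v → f u v * w G u v) (λ v → g u v * w G u v)) ⟨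
    (Σ-fin λ u → Σ-fin λ v → f u v * w G u v + g u v * w G u v)
      ≡⟨ sum-cong-≗ (λ u → sum-cong-≗ λ v → *-distribʳ-+ (w G u v) (f u v) (g u v)) ⟨
    weighted G (λ u v → f u v + g u v) ∎
    where open ≡-Reasoning

  weighted-transpose : ∀ (f : Fin n → Fin n → ℚ) → weighted G (λ u v → f v u) ≡ weighted G f
  weighted-transpose f = begin
    (Σ-fin λ u → Σ-fin λ v → f v u * w G u v) ≡⟨ ∑-comm (λ u v → f v u * w G u v) ⟩
    (Σ-fin λ v → Σ-fin λ u → f v u * w G u v) ≡⟨ sum-cong-≗ (λ v → sum-cong-≗ λ u → cong (f v u *_) (symm G u v)) ⟩
    weighted G f ∎
    where open ≡-Reasoning

  weighted-mono-≤ : ∀ {f g : Fin n → Fin n → ℚ} → (∀ u v → f u v ≤ g u v) → weighted G f ≤ weighted G g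
  weighted-mono-≤ f≤g = sum-mono-≤ λ u → sum-mono-≤ λ v →
    *-monoʳ-≤-nonNeg (w G u v) {{nonNegative (nonneg G u v)}} (f≤g u v)

cut : ∀ {n} → WeightedGraph n → (Fin n → Bool) → ℚ
cut G χ = weighted G λ u v → 𝟙 (χ u ∧ not (χ v))

𝟙-separates : ∀ a b → 𝟙 (a ∧ not b) + 𝟙 (b ∧ not a) ≡ 𝟙 (a xor b)
𝟙-separates true  true  = refl
𝟙-separates true  false = refl
𝟙-separates false true  = refl
𝟙-separates false false = refl

separates : ∀ {n} → (Fin n → Bool) → Fin n → Fin n → ℚ
separates χ u v = 𝟙 (χ u xor χ v)

cut-+-cut : ∀ {n} (G : WeightedGraph n) (χ : Fin n → Bool) → cut G χ + cut G χ ≡ weighted G (separates χ)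
cut-+-cut G χ = begin
  cut G χ + cut G χ
    ≡⟨ cong (cut G χ +_) (weighted-transpose G (λ u v → 𝟙 (χ u ∧ not (χ v)))) ⟨
  cut G χ + weighted G (λ u v → 𝟙 (χ v ∧ not (χ u)))
    ≡⟨ weighted-+ G (λ u v → 𝟙 (χ u ∧ not (χ v))) (λ u v → 𝟙 (χ v ∧ not (χ u))) ⟩
  weighted G (λ u v → 𝟙 (χ u ∧ not (χ v)) + 𝟙 (χ v ∧ not (χ u)))
    ≡⟨ weighted-cong G (λ u v → 𝟙-separates (χ u) (χ v)) ⟩
  weighted G (separates χ) ∎
  where open ≡-Reasoning

-- a, b are the memberships of one endpoint in X, Y and c, e those of the other.
separation-posimodular : ∀ a b c e →
  𝟙 ((a ∧ not b) xor (c ∧ not e)) + 𝟙 ((b ∧ not a) xor (e ∧ not c)) ≤ 𝟙 (a xor c) + 𝟙 (b xor e)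
separation-posimodular true  true  true  true  = ≤-by-decision _ _
separation-posimodular true  true  true  false = ≤-by-decision _ _
separation-posimodular true  true  false true  = ≤-by-decision _ _
separation-posimodular true  true  false false = ≤-by-decision _ _
separation-posimodular true  false true  true  = ≤-by-decision _ _
separation-posimodular true  false true  false = ≤-by-decision _ _
separation-posimodular true  false false true  = ≤-by-decision _ _
separation-posimodular true  false false false = ≤-by-decision _ _
separation-posimodular false true  true  true  = ≤-by-decision _ _
separation-posimodular false true  true  false = ≤-by-decision _ _
separation-posimodular false true  false true  = ≤-by-decision _ _
separation-posimodular false true  false false = ≤-by-decision _ _
separation-posimodular false false true  true  = ≤-by-decision _ _
separation-posimodular false false true  false = ≤-by-decision _ _
separation-posimodular false false false true  = ≤-by-decision _ _
separation-posimodular false false false false = ≤-by-decision _ _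

-- Posimodularity fails summand by summand for the ordered pairs of cut, but
-- holds for the symmetrised summands of cut G χ + cut G χ.
cut-posimodular : ∀ {n} (G : WeightedGraph n) (χ ψ : Fin n → Bool) →
  cut G (λ u → χ u ∧ not (ψ u)) + cut G (λ u → ψ u ∧ not (χ u)) ≤ cut G χ + cut G ψ
cut-posimodular G χ ψ = +-self-cancel-≤ (begin
  (A + B) + (A + B)
    ≡⟨ interchange A B A B ⟩
  (A + A) + (B + B)
    ≡⟨ cong₂ _+_ (cut-+-cut G χ∖ψ) (cut-+-cut G ψ∖χ) ⟩
  weighted G (separates χ∖ψ) + weighted G (separates ψ∖χ)
    ≡⟨ weighted-+ G (separates χ∖ψ) (separates ψ∖χ) ⟩
  weighted G (λ u v → separates χ∖ψ u v + separates ψ∖χ u v)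
    ≤⟨ weighted-mono-≤ G (λ u v → separation-posimodular (χ u) (ψ u) (χ v) (ψ v)) ⟩
  weighted G (λ u v → separates χ u v + separates ψ u v)
    ≡⟨ weighted-+ G (separates χ) (separates ψ) ⟨
  weighted G (separates χ) + weighted G (separates ψ)
    ≡⟨ cong₂ _+_ (cut-+-cut G χ) (cut-+-cut G ψ) ⟨
  (cut G χ + cut G χ) + (cut G ψ + cut G ψ)
    ≡⟨ interchange (cut G χ) (cut G χ) (cut G ψ) (cut G ψ) ⟩
  (cut G χ + cut G ψ) + (cut G χ + cut G ψ) ∎)
  where
  open ≤-Reasoning
  χ∖ψ ψ∖χ : Fin _ → Bool
  χ∖ψ u = χ u ∧ not (ψ u)
  ψ∖χ u = ψ u ∧ not (χ u)
  A B : ℚ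
  A = cut G χ∖ψ
  B = cut G ψ∖χ

-- The crossing function in d is local to its where-block and cannot be named,
-- so the left-hand side of d-summand is left to be inferred from its use in d≡cut.
d-summand : ∀ {n} (G : WeightedGraph n) (X : Subset n) (u v : Fin n) →
  _ ≡ 𝟙 (lookup X u ∧ not (lookup X v)) * w G u v

d≡cut : ∀ {n} (G : WeightedGraph n) (X : Subset n) → d G X ≡ cut G (lookup X)
d≡cut G X = sum-cong-≗ λ u → sum-cong-≗ λ v → d-summand G X u v

d-summand G X u v with lookup X u ∧ not (lookup X v)
... | true  = sym (*-identityˡ (w G u v))
... | false = sym (*-zeroˡ (w G u v))

cut-cong : ∀ {n} (G : WeightedGraph n) {χ ψ : Fin n → Bool} → χ ≗ ψ → cut G χ ≡ cut G ψ
cut-cong G χ≗ψ = weighted-cong G λ u v → cong₂ (λ a b → 𝟙 (a ∧ not b)) (χ≗ψ u) (χ≗ψ v)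

lookup-─ : ∀ {n} (p q : Subset n) (u : Fin n) → lookup (p ─ q) u ≡ lookup p u ∧ not (lookup q u)
lookup-─ (inside  ∷ p) (inside  ∷ q) zero    = refl
lookup-─ (inside  ∷ p) (outside ∷ q) zero    = refl
lookup-─ (outside ∷ p) (inside  ∷ q) zero    = refl
lookup-─ (outside ∷ p) (outside ∷ q) zero    = refl
lookup-─ (_       ∷ p) (_       ∷ q) (suc u) = lookup-─ p q u

d-posimodular : ∀ {n} (G : WeightedGraph n) (X Y : Subset n) →
  d G (X ─ Y) + d G (Y ─ X) ≤ d G X + d G Y
d-posimodular G X Y = subst₂ _≤_
  (sym (cong₂ _+_ (d-─ X Y) (d-─ Y X)))
  (sym (cong₂ _+_ (d≡cut G X) (d≡cut G Y)))
  (cut-posimodular G (lookup X) (lookup Y))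
  where
  d-─ : ∀ X Y → d G (X ─ Y) ≡ cut G (λ u → lookup X u ∧ not (lookup Y u))
  d-─ X Y = trans (d≡cut G (X ─ Y)) (cut-cong G (lookup-─ X Y))

─-steinerCut : ∀ {n} {T X : Subset n} (Y : Subset n) → SteinerCut T X →
  (∀ {t} → t ∈ X → t ∈ Y → t ∉ T) → SteinerCut T (X ─ Y)
─-steinerCut {T = T} {X} Y ((t , t∈X∩T) , T⊈X) X∩Y∩T≡∅ =
  (t , x∈p∩q⁺ (x∈p∧x∉q⇒x∈p─q t∈X (λ t∈Y → X∩Y∩T≡∅ t∈X t∈Y t∈T) , t∈T)) ,
  λ T⊆X─Y → T⊈X (⊆-trans T⊆X─Y (p─q⊆p X Y))
  where
  t∈X : t ∈ X
  t∈X = proj₁ (x∈p∩q⁻ X T t∈X∩T)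
  t∈T : t ∈ T
  t∈T = proj₂ (x∈p∩q⁻ X T t∈X∩T)

extreme-─ : ∀ {n} (G : WeightedGraph n) {T X : Subset n} (Y : Subset n) → Extreme G T X →
  Nonempty (X ∩ Y) → (∀ {t} → t ∈ X → t ∈ Y → t ∉ T) → d G X < d G (X ─ Y)
extreme-─ G {X = X} Y (X-cut , X-extreme) X∩Y≢∅ X∩Y∩T≡∅ =
  X-extreme (X ─ Y) (p∩q≢∅⇒p─q⊂p X Y X∩Y≢∅) (─-steinerCut Y X-cut X∩Y∩T≡∅)

mainTheorem3 : ∀ (n : ℕ) (G : WeightedGraph n) (T X Y : Subset n) →
    Extreme G T X → Extreme G T Y → Nonempty (X ∩ Y) → SteinerCut T (X ∩ Y)
mainTheorem3 _ G T X Y X-extreme Y-extreme X∩Y≢∅ =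
  decidable-stable (nonempty? ((X ∩ Y) ∩ T)) meets-T ,
  λ T⊆X∩Y → proj₂ (proj₁ X-extreme) (⊆-trans T⊆X∩Y (p∩q⊆p X Y))
  where
  meets-T : ¬ ¬ Nonempty ((X ∩ Y) ∩ T)
  meets-T X∩Y∩T≡∅ = <-irrefl refl (<-≤-trans
    (+-mono-< (extreme-─ G Y X-extreme X∩Y≢∅ outside-T)
              (extreme-─ G X Y-extreme (subst Nonempty (∩-comm X Y) X∩Y≢∅) (flip outside-T)))
    (d-posimodular G X Y))
    where
    outside-T : ∀ {t} → t ∈ X → t ∈ Y → t ∉ T
    outside-T t∈X t∈Y t∈T = X∩Y∩T≡∅ (_ , x∈p∩q⁺ (x∈p∩q⁺ (t∈X , t∈Y) , t∈T))
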